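{- Let $G$ be the $(n\times n)$-grid and let $Q\subseteq V_1$ be a left-pyramidal set with two different left spots $(i_1,j_1)$ and $(i_2,j_2)$, such that $(i_1,j_1)$ has the smallest and $(i_2,j_2)$ has the largest $x$-coordinate among all left spots of $Q$. Let $Q'=(Q\setminus\{(i_2,j_2)\})\cup\{(i_1-1,j_1+1)\}$. Then $Q'$ is a left-pyramidal set and $\delta(Q')\le\delta(Q)$.
   Context: The $(n\times n)$-grid $G$ has vertex set $\{(x,y): x,y\in\mathbb Z,\ 1\le x,y\le n\}$, with $(x,y)$ adjacent to $(x',y')$ iff $|x-x'|+|y-y'|=1$. $V_1=\{(x,y): x+y \text{ even}\}$. For $S\subseteq V(G)$, $N(S)=\bigcup_{v\in S}N(v)\setminus S$ and $\delta(S)=|N(S)|$. A set $Q\subseteq V_1$ is pyramidal if for every $(x,y)\in Q$ with $y\ge2$ we have $(x-1,y-1)\in Q$ whenever $x\ge2$, and $(x+1,y-1)\in Q$ whenever $x\le n-1$. A pyramidal set $Q$ is left-pyramidal if $(x,y)\in Q$ with $x\ge3$ implies $(x-2,y)\in Q$. A left-pyramidal set $Q$ has a left spot at $(i,j)$ if $(i,j)\in Q$ and $(i-1,j+1)\in V(G)\setminus Q$ (in particular $(i-1,j+1)$ is a vertex of $G$). -}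

module Defs where

open import Data.Nat using (ℕ; zero; suc; _+_; _∸_; _≤_; _≤ᵇ_; _%_; _≡ᵇ_)
open import Data.Bool using (Bool; true; false; _∧_; _∨_; not; if_then_else_)
open import Data.List using (List; []; _∷_; map; upTo; concatMap)
open import Data.Bool.ListAction using (any)
open import Data.Nat.ListAction using (sum)
open import Data.Product using (_×_; _,_)
open import Relation.Binary.PropositionalEquality using (_≡_)

Subset : Set
Subset = ℕ → ℕ → Bool

_∈_ : ℕ × ℕ → Subset → Set
(x , y) ∈ S = S x y ≡ true

InGrid : ℕ → ℕ → ℕ → Set
InGrid n x y = (1 ≤ x) × (x ≤ n) × (1 ≤ y) × (y ≤ n)

inGridᵇ : ℕ → ℕ → ℕ → Bool
inGridᵇ n x y = (1 ≤ᵇ x) ∧ (x ≤ᵇ n) ∧ (1 ≤ᵇ y) ∧ (y ≤ᵇ n)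

InV₁ : ℕ → ℕ → ℕ → Set
InV₁ n x y = InGrid n x y × ((x + y) % 2 ≡ 0)

SubsetV₁ : ℕ → Subset → Set
SubsetV₁ n Q = ∀ x y → (x , y) ∈ Q → InV₁ n x y

Pyramidal : ℕ → Subset → Set
Pyramidal n Q =
  SubsetV₁ n Q ×
  (∀ x y → (x , y) ∈ Q → 2 ≤ y →
     (2 ≤ x → (x ∸ 1 , y ∸ 1) ∈ Q) ×
     (x ≤ n ∸ 1 → (x + 1 , y ∸ 1) ∈ Q))

LeftPyramidal : ℕ → Subset → Set
LeftPyramidal n Q =
  Pyramidal n Q ×
  (∀ x y → (x , y) ∈ Q → 3 ≤ x → (x ∸ 2 , y) ∈ Q)

-- Q has a left spot at (i , j): (i , j) ∈ Q, and (i-1 , j+1) is a grid vertex not in Q.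
-- (InGrid n (i ∸ 1) (j + 1) includes 1 ≤ i ∸ 1, so i ≥ 2 and i ∸ 1 is the true i - 1.)
LeftSpot : ℕ → Subset → ℕ → ℕ → Set
LeftSpot n Q i j = ((i , j) ∈ Q) × InGrid n (i ∸ 1) (j + 1) × (Q (i ∸ 1) (j + 1) ≡ false)

neighbours : ℕ → ℕ → ℕ → List (ℕ × ℕ)
neighbours n x y =
  filterGrid ((suc x , y) ∷ (x ∸ 1 , y) ∷ (x , suc y) ∷ (x , y ∸ 1) ∷ [])
  where
  filterGrid : List (ℕ × ℕ) → List (ℕ × ℕ)
  filterGrid [] = []
  filterGrid ((a , b) ∷ ps) =
    if inGridᵇ n a b then (a , b) ∷ filterGrid ps else filterGrid ps

inNᵇ : ℕ → Subset → ℕ → ℕ → Bool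
inNᵇ n S x y =
  inGridᵇ n x y ∧ not (S x y) ∧ any (λ { (a , b) → S a b }) (neighbours n x y)

range1 : ℕ → List ℕ
range1 n = map suc (upTo n)

δ : ℕ → Subset → ℕ
δ n S = sum (concatMap (λ x → map (λ y → if inNᵇ n S x y then 1 else 0) (range1 n)) (range1 n))

eqPairᵇ : ℕ → ℕ → ℕ → ℕ → Bool
eqPairᵇ a b c d = (a ≡ᵇ c) ∧ (b ≡ᵇ d)

move : Subset → ℕ → ℕ → ℕ → ℕ → Subset
move Q i₁ j₁ i₂ j₂ x y =
  (Q x y ∧ not (eqPairᵇ x y i₂ j₂)) ∨ eqPairᵇ x y (i₁ ∸ 1) (j₁ + 1)

module Submission where

-- Left-pyramidality: u is supported by (i₁ - 2 , j₁), (i₁ , j₁) and (i₁ - 3 , j₁ + 1) (the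
-- last because otherwise (i₁ - 2 , j₁) would be a left spot left of the leftmost one), and
-- w supports no vertex of Q, since (i₂ ± 1 , j₂ + 1) and (i₂ + 2 , j₂) are not in Q (the
-- last because otherwise it would be a left spot right of the rightmost one).
-- Boundary: every neighbour of u except a = (i₁ - 1 , j₁ + 2) already has a neighbour in Q,
-- so N(Q′) ⊆ N(Q) ∪ {a}, while b = (i₂ , j₂ + 1) lies in N(Q) but not in N(Q′); counting
-- grid vertices then gives δ(Q′) ≤ δ(Q).

open import Defs
open import Data.Nat using (ℕ; zero; suc; pred; _+_; _∸_; _≤_; _<_; z≤n; s≤s; _≡ᵇ_; _≤ᵇ_; _%_)
open import Data.Nat.Properties
  using (≤ᵇ⇒≤; ≤⇒≤ᵇ; ≡ᵇ⇒≡; ≡⇒≡ᵇ; _≟_; +-comm; +-suc; +-identityʳ; +-commutativeSemigroup;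
         m+n∸n≡m; m∸n≤m; +-mono-≤; +-monoʳ-≤; +-cancelʳ-≤; m≤m+n; m≤n+m; m≤n⇒m≤1+n;
         ≤-reflexive; ≤-trans; ≤-<-trans; ≤-pred; n≤1+n; <⇒≤; <⇒≱; <⇒≢; ≤∧≢⇒<; <-trans;
         n<1+n; m<1+n⇒m≤n; module ≤-Reasoning)
open import Data.Nat.ListAction using (sum)
open import Data.Bool.ListAction using (any)
open import Data.Nat.ListAction.Properties using (sum-++)
open import Data.Bool using (Bool; true; false; _∧_; _∨_; not; if_then_else_)
open import Data.Bool.Properties using (T-≡; ¬-not)
open import Data.List using (List; []; _∷_; map; upTo; concatMap; _++_)
open import Data.List.Relation.Unary.Any using (Any; here; there)
open import Data.List.Properties using (map-++; map-cong; upTo-∷ʳ)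
open import Data.Product using (_×_; _,_; Σ; proj₁; proj₂)
open import Data.Product.Properties using (≡-dec)
open import Data.Sum using (_⊎_; inj₁; inj₂; map₁; map₂)
open import Data.Empty using (⊥; ⊥-elim)
open import Function.Base using (_∘′_; case_of_)
open import Function.Bundles using (_⇔_; mk⇔; Equivalence)
open import Relation.Nullary using (¬_; yes; no)
open import Relation.Binary.PropositionalEquality
open import Algebra.Properties.CommutativeSemigroup +-commutativeSemigroup using (interchange)

open Equivalence using (to; from)

∧-elim : ∀ {a b} → a ∧ b ≡ true → a ≡ true × b ≡ true
∧-elim {true} {true} _ = refl , refl

∧-intro : ∀ {a b} → a ≡ true → b ≡ true → a ∧ b ≡ true
∧-intro refl refl = refl

∨-elim : ∀ {a b} → a ∨ b ≡ true → a ≡ true ⊎ b ≡ true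
∨-elim {true}  _ = inj₁ refl
∨-elim {false} b = inj₂ b

∨-introˡ : ∀ {a} b → a ≡ true → a ∨ b ≡ true
∨-introˡ b refl = refl

∨-introʳ : ∀ a {b} → b ≡ true → a ∨ b ≡ true
∨-introʳ true  _ = refl
∨-introʳ false b = b

not-true : ∀ {a} → not a ≡ true → a ≡ false
not-true {false} _ = refl

≤ᵇ⇔ : ∀ {m k} → (m ≤ᵇ k) ≡ true ⇔ m ≤ k
≤ᵇ⇔ {m} {k} = mk⇔ (λ e → ≤ᵇ⇒≤ m k (from T-≡ e)) (λ le → to T-≡ (≤⇒≤ᵇ le))

≡ᵇ⇔ : ∀ {m k} → (m ≡ᵇ k) ≡ true ⇔ m ≡ k
≡ᵇ⇔ {m} {k} = mk⇔ (λ e → ≡ᵇ⇒≡ m k (from T-≡ e)) (λ e → to T-≡ (≡⇒≡ᵇ m k e))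

inGridᵇ⇔ : ∀ {n x y} → inGridᵇ n x y ≡ true ⇔ InGrid n x y
inGridᵇ⇔ = mk⇔ sound complete
  where
  sound : ∀ {n x y} → inGridᵇ n x y ≡ true → InGrid n x y
  sound e with ∧-elim e
  ... | a , e′ with ∧-elim e′
  ... | b , e″ with ∧-elim e″
  ... | c , d = to ≤ᵇ⇔ a , to ≤ᵇ⇔ b , to ≤ᵇ⇔ c , to ≤ᵇ⇔ d
  complete : ∀ {n x y} → InGrid n x y → inGridᵇ n x y ≡ true
  complete (a , b , c , d) =
    ∧-intro (from ≤ᵇ⇔ a) (∧-intro (from ≤ᵇ⇔ b) (∧-intro (from ≤ᵇ⇔ c) (from ≤ᵇ⇔ d)))

eqPairᵇ⇔ : ∀ {x y a b} → eqPairᵇ x y a b ≡ true ⇔ (x , y) ≡ (a , b)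
eqPairᵇ⇔ {x} {y} = mk⇔
  (λ e → let (e₁ , e₂) = ∧-elim e in cong₂ _,_ (to ≡ᵇ⇔ e₁) (to ≡ᵇ⇔ e₂))
  (λ { refl → ∧-intro (from (≡ᵇ⇔ {x}) refl) (from (≡ᵇ⇔ {y}) refl) })

sumTo : ℕ → (ℕ → ℕ) → ℕ
sumTo zero    f = 0
sumTo (suc n) f = sumTo n f + f (suc n)

sum-range1 : ∀ n f → sum (map f (range1 n)) ≡ sumTo n f
sum-range1 zero    f = refl
sum-range1 (suc n) f = begin
  sum (map f (map suc (upTo (suc n))))
    ≡⟨ cong (λ l → sum (map f (map suc l))) (sym (upTo-∷ʳ n)) ⟩
  sum (map f (map suc (upTo n ++ n ∷ [])))
    ≡⟨ cong (λ l → sum (map f l)) (map-++ suc (upTo n) (n ∷ [])) ⟩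
  sum (map f (range1 n ++ suc n ∷ []))
    ≡⟨ cong sum (map-++ f (range1 n) (suc n ∷ [])) ⟩
  sum (map f (range1 n) ++ f (suc n) ∷ [])
    ≡⟨ sum-++ (map f (range1 n)) (f (suc n) ∷ []) ⟩
  sum (map f (range1 n)) + (f (suc n) + 0)
    ≡⟨ cong₂ _+_ (sum-range1 n f) (+-identityʳ (f (suc n))) ⟩
  sumTo n f + f (suc n) ∎
  where open ≡-Reasoning

sum-concatMap : ∀ {A : Set} (g : A → List ℕ) (xs : List A) →
  sum (concatMap g xs) ≡ sum (map (λ x → sum (g x)) xs)
sum-concatMap g []       = refl
sum-concatMap g (x ∷ xs) =
  trans (sum-++ (g x) (concatMap g xs)) (cong (sum (g x) +_) (sum-concatMap g xs))

⟦_⟧ : Bool → ℕ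
⟦ b ⟧ = if b then 1 else 0

count : ℕ → (ℕ → ℕ → Bool) → ℕ
count n f = sumTo n (λ x → sumTo n (λ y → ⟦ f x y ⟧))

δ≡count : ∀ n S → δ n S ≡ count n (inNᵇ n S)
δ≡count n S = begin
  sum (concatMap (λ x → map (λ y → ⟦ inNᵇ n S x y ⟧) (range1 n)) (range1 n))
    ≡⟨ sum-concatMap (λ x → map (λ y → ⟦ inNᵇ n S x y ⟧) (range1 n)) (range1 n) ⟩
  sum (map (λ x → sum (map (λ y → ⟦ inNᵇ n S x y ⟧) (range1 n))) (range1 n))
    ≡⟨ cong sum (map-cong (λ x → sum-range1 n (λ y → ⟦ inNᵇ n S x y ⟧)) (range1 n)) ⟩
  sum (map (λ x → sumTo n (λ y → ⟦ inNᵇ n S x y ⟧)) (range1 n))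
    ≡⟨ sum-range1 n _ ⟩
  count n (inNᵇ n S) ∎
  where open ≡-Reasoning

sumTo-transfer : ∀ n {h u k w : ℕ → ℕ} → (∀ x → h x + u x ≤ k x + w x) →
  sumTo n h + sumTo n u ≤ sumTo n k + sumTo n w
sumTo-transfer zero    _ = z≤n
sumTo-transfer (suc n) {h} {u} {k} {w} le = begin
  (sumTo n h + h (suc n)) + (sumTo n u + u (suc n))
    ≡⟨ interchange (sumTo n h) (h (suc n)) (sumTo n u) (u (suc n)) ⟩
  (sumTo n h + sumTo n u) + (h (suc n) + u (suc n))
    ≤⟨ +-mono-≤ (sumTo-transfer n le) (le (suc n)) ⟩
  (sumTo n k + sumTo n w) + (k (suc n) + w (suc n))
    ≡⟨ interchange (sumTo n k) (sumTo n w) (k (suc n)) (w (suc n)) ⟩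
  (sumTo n k + k (suc n)) + (sumTo n w + w (suc n)) ∎
  where open ≤-Reasoning

sumTo-cong : ∀ n {f g : ℕ → ℕ} → (∀ x → f x ≡ g x) → sumTo n f ≡ sumTo n g
sumTo-cong zero    _ = refl
sumTo-cong (suc n) e = cong₂ _+_ (sumTo-cong n e) (e (suc n))

sumTo-zero : ∀ n → sumTo n (λ _ → 0) ≡ 0
sumTo-zero zero    = refl
sumTo-zero (suc n) = cong (_+ 0) (sumTo-zero n)

pointMass : ℕ → ℕ → ℕ → ℕ
pointMass a c x = if x ≡ᵇ a then c else 0

pointMass-at : ∀ a c → pointMass a c a ≡ c
pointMass-at a c rewrite from (≡ᵇ⇔ {a}) refl = refl

pointMass-off : ∀ {a x} c → x ≢ a → pointMass a c x ≡ 0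
pointMass-off {a} {x} c x≢a rewrite ¬-not {x ≡ᵇ a} (x≢a ∘′ to ≡ᵇ⇔) = refl

sumTo-pointMass-beyond : ∀ n {a} c → n < a → sumTo n (pointMass a c) ≡ 0
sumTo-pointMass-beyond zero    c _  = refl
sumTo-pointMass-beyond (suc n) c lt =
  cong₂ _+_ (sumTo-pointMass-beyond n c (<-trans (n<1+n n) lt)) (pointMass-off c (<⇒≢ lt))

sumTo-pointMass-≤ : ∀ n a c → sumTo n (pointMass a c) ≤ c
sumTo-pointMass-≤ zero    a c = z≤n
sumTo-pointMass-≤ (suc n) a c with suc n ≟ a
... | yes refl = ≤-reflexive
      (cong₂ _+_ (sumTo-pointMass-beyond n c (n<1+n n)) (pointMass-at (suc n) c))
... | no  ne   rewrite pointMass-off c ne | +-identityʳ (sumTo n (pointMass a c)) =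
      sumTo-pointMass-≤ n a c

sumTo-pointMass : ∀ n {a} c → 1 ≤ a → a ≤ n → sumTo n (pointMass a c) ≡ c
sumTo-pointMass zero    c (s≤s _) ()
sumTo-pointMass (suc n) {a} c 1≤a a≤1+n with suc n ≟ a
... | yes refl = cong₂ _+_ (sumTo-pointMass-beyond n c (n<1+n n)) (pointMass-at (suc n) c)
... | no  ne   rewrite pointMass-off c ne | +-identityʳ (sumTo n (pointMass a c)) =
      sumTo-pointMass n c 1≤a (m<1+n⇒m≤n (≤∧≢⇒< a≤1+n (ne ∘′ sym)))

cell : ℕ → ℕ → ℕ → ℕ → ℕ
cell a b x y = ⟦ eqPairᵇ x y a b ⟧

sumTo-cell : ∀ n a b x → sumTo n (cell a b x) ≡ pointMass a (sumTo n (pointMass b 1)) x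
sumTo-cell n a b x with x ≡ᵇ a
... | true  = refl
... | false = sumTo-zero n

count-cell-≤ : ∀ n a b → sumTo n (λ x → sumTo n (cell a b x)) ≤ 1
count-cell-≤ n a b = begin
  sumTo n (λ x → sumTo n (cell a b x))               ≡⟨ sumTo-cong n (sumTo-cell n a b) ⟩
  sumTo n (pointMass a (sumTo n (pointMass b 1)))    ≤⟨ sumTo-pointMass-≤ n a _ ⟩
  sumTo n (pointMass b 1)                            ≤⟨ sumTo-pointMass-≤ n b 1 ⟩
  1                                                  ∎
  where open ≤-Reasoning

count-cell : ∀ n {a b} → InGrid n a b → sumTo n (λ x → sumTo n (cell a b x)) ≡ 1
count-cell n {a} {b} (1≤a , a≤n , 1≤b , b≤n) = begin
  sumTo n (λ x → sumTo n (cell a b x))               ≡⟨ sumTo-cong n (sumTo-cell n a b) ⟩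
  sumTo n (pointMass a (sumTo n (pointMass b 1)))    ≡⟨ sumTo-pointMass n _ 1≤a a≤n ⟩
  sumTo n (pointMass b 1)                            ≡⟨ sumTo-pointMass n 1 1≤b b≤n ⟩
  1                                                  ∎
  where open ≡-Reasoning

indicator-exchange : ∀ {f g a b : Bool} →
  (g ≡ true → f ≡ true ⊎ a ≡ true) → (b ≡ true → f ≡ true × g ≡ false) →
  ⟦ g ⟧ + ⟦ b ⟧ ≤ ⟦ f ⟧ + ⟦ a ⟧
indicator-exchange {g = false} {b = false} _    _    = z≤n
indicator-exchange {g = false} {a} {true}  _    atB with atB refl
... | refl , _ = m≤m+n 1 ⟦ a ⟧
indicator-exchange {g = true}  {b = true}  _    atB with atB refl
... | _ , ()
indicator-exchange {f} {true}  {a} {false} g⊆f∪a _ with g⊆f∪a refl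
... | inj₁ refl = s≤s z≤n
... | inj₂ refl = m≤n+m 1 ⟦ f ⟧

count-exchange : ∀ n (f g : ℕ → ℕ → Bool) {a₁ a₂ b₁ b₂} →
  InGrid n b₁ b₂ → f b₁ b₂ ≡ true → g b₁ b₂ ≡ false →
  (∀ x y → g x y ≡ true → f x y ≡ true ⊎ (x , y) ≡ (a₁ , a₂)) →
  count n g ≤ count n f
count-exchange n f g {a₁} {a₂} {b₁} {b₂} b-grid fb gb g⊆f∪a =
  +-cancelʳ-≤ 1 (count n g) (count n f) (begin
    count n g + 1                           ≡⟨ cong (count n g +_) (sym (count-cell n b-grid)) ⟩
    count n g + cellCount b₁ b₂             ≤⟨ sumTo-transfer n (λ x → sumTo-transfer n (pointwise x)) ⟩
    count n f + cellCount a₁ a₂             ≤⟨ +-monoʳ-≤ (count n f) (count-cell-≤ n a₁ a₂) ⟩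
    count n f + 1                           ∎)
  where
  open ≤-Reasoning
  cellCount : ℕ → ℕ → ℕ
  cellCount a b = sumTo n (λ x → sumTo n (cell a b x))
  pointwise : ∀ x y → ⟦ g x y ⟧ + cell b₁ b₂ x y ≤ ⟦ f x y ⟧ + cell a₁ a₂ x y
  pointwise x y = indicator-exchange
    (λ gxy → map₂ (from (eqPairᵇ⇔ {x} {y})) (g⊆f∪a x y gxy))
    (λ atB → case to (eqPairᵇ⇔ {x} {y}) atB of λ { refl → fb , gb })

data Direction : Set where
  right left up down : Direction

step : Direction → ℕ → ℕ → ℕ × ℕ
step right x y = suc x , y
step left  x y = x ∸ 1 , y
step up    x y = x , suc y
step down  x y = x , y ∸ 1

Occupied : ℕ → Subset → ℕ × ℕ → Set
Occupied n S v = InGrid n (proj₁ v) (proj₂ v) × S (proj₁ v) (proj₂ v) ≡ true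

InN : ℕ → Subset → ℕ → ℕ → Set
InN n S x y = InGrid n x y × S x y ≡ false × Σ Direction (λ d → Occupied n S (step d x y))

-- the filter of `neighbours`: `neighbours n x y` computes to `inGridOnly n` applied to
-- the four steps from (x , y), so the next two lemmas characterise its `any`
inGridOnly : ℕ → List (ℕ × ℕ) → List (ℕ × ℕ)
inGridOnly n []             = []
inGridOnly n ((a , b) ∷ vs) = if inGridᵇ n a b then (a , b) ∷ inGridOnly n vs else inGridOnly n vs

any-inGridOnly⇔ : ∀ n S vs →
  any (λ v → S (proj₁ v) (proj₂ v)) (inGridOnly n vs) ≡ true ⇔ Any (Occupied n S) vs
any-inGridOnly⇔ n S vs = mk⇔ (sound vs) (complete vs)
  where
  sound : ∀ vs → any (λ v → S (proj₁ v) (proj₂ v)) (inGridOnly n vs) ≡ true → Any (Occupied n S) vs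
  sound ((a , b) ∷ vs) e with inGridᵇ n a b in g
  ... | false = there (sound vs e)
  ... | true with ∨-elim e
  ...   | inj₁ s  = here (to inGridᵇ⇔ g , s)
  ...   | inj₂ e′ = there (sound vs e′)
  complete : ∀ vs → Any (Occupied n S) vs → any (λ v → S (proj₁ v) (proj₂ v)) (inGridOnly n vs) ≡ true
  complete ((a , b) ∷ vs) (here (grid , s)) rewrite from inGridᵇ⇔ grid = ∨-introˡ _ s
  complete ((a , b) ∷ vs) (there p) with inGridᵇ n a b
  ... | true  = ∨-introʳ (S a b) (complete vs p)
  ... | false = complete vs p

any-direction⇔ : ∀ {P : ℕ × ℕ → Set} x y →
  Any P (map (λ d → step d x y) (right ∷ left ∷ up ∷ down ∷ [])) ⇔ Σ Direction (λ d → P (step d x y))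
any-direction⇔ {P} x y = mk⇔ sound complete
  where
  candidates : List (ℕ × ℕ)
  candidates = map (λ d → step d x y) (right ∷ left ∷ up ∷ down ∷ [])
  sound : Any P candidates → Σ Direction (λ d → P (step d x y))
  sound (here p)                         = right , p
  sound (there (here p))                 = left  , p
  sound (there (there (here p)))         = up    , p
  sound (there (there (there (here p)))) = down  , p
  complete : Σ Direction (λ d → P (step d x y)) → Any P candidates
  complete (right , p) = here p
  complete (left  , p) = there (here p)
  complete (up    , p) = there (there (here p))
  complete (down  , p) = there (there (there (here p)))

inN⇔ : ∀ n S x y → inNᵇ n S x y ≡ true ⇔ InN n S x y
inN⇔ n S x y = mk⇔ sound complete
  where
  sound : inNᵇ n S x y ≡ true → InN n S x y
  sound e with ∧-elim e
  ... | g , e′ with ∧-elim e′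
  ... | s , a = to inGridᵇ⇔ g , not-true s ,
                to (any-direction⇔ x y) (to (any-inGridOnly⇔ n S _) a)
  complete : InN n S x y → inNᵇ n S x y ≡ true
  complete (g , s , nb) = ∧-intro (from inGridᵇ⇔ g) (∧-intro (cong not s)
    (from (any-inGridOnly⇔ n S _) (from (any-direction⇔ x y) nb)))

even-suc : ∀ m → m % 2 ≡ 0 → suc m % 2 ≡ 0 → ⊥
even-suc zero          _ ()
even-suc (suc zero)    ()
even-suc (suc (suc m)) = even-suc m

V₁-independent : ∀ n d {x y} → InV₁ n x y → ¬ InV₁ n (proj₁ (step d x y)) (proj₂ (step d x y))
V₁-independent n right {x}     {y}     (_ , even) (_ , even′) = even-suc (x + y) even even′
V₁-independent n left  {suc x} {y}     (_ , even) (_ , even′) = even-suc (x + y) even′ even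
V₁-independent n up    {x}     {y}     (_ , even) (_ , even′) =
  even-suc (x + y) even (subst (λ m → m % 2 ≡ 0) (+-suc x y) even′)
V₁-independent n down  {x}     {suc y} (_ , even) (_ , even′) =
  even-suc (x + y) even′ (subst (λ m → m % 2 ≡ 0) (+-suc x y) even)

IsExchange : Subset → Subset → ℕ × ℕ → ℕ × ℕ → Set
IsExchange Q Q′ w u = ∀ x y → (x , y) ∈ Q′ ⇔ ((((x , y) ∈ Q) × (x , y) ≢ w) ⊎ (x , y) ≡ u)

move-isExchange : ∀ Q a b c d → IsExchange Q (move Q a b c d) (c , d) (a ∸ 1 , b + 1)
move-isExchange Q a b c d x y = mk⇔ leave enter
  where
  leave : (x , y) ∈ move Q a b c d → (((x , y) ∈ Q) × (x , y) ≢ (c , d)) ⊎ (x , y) ≡ (a ∸ 1 , b + 1)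
  leave e with ∨-elim e
  ... | inj₂ added = inj₂ (to eqPairᵇ⇔ added)
  ... | inj₁ kept with ∧-elim kept
  ...   | q , notW = inj₁ (q , λ isW → case trans (sym (from eqPairᵇ⇔ isW)) (not-true notW) of λ ())
  enter : (((x , y) ∈ Q) × (x , y) ≢ (c , d)) ⊎ (x , y) ≡ (a ∸ 1 , b + 1) → (x , y) ∈ move Q a b c d
  enter (inj₁ (q , notW)) = ∨-introˡ _ (∧-intro q (cong not (¬-not (notW ∘′ to eqPairᵇ⇔))))
  enter (inj₂ added)      = ∨-introʳ _ (from eqPairᵇ⇔ added)

in-and-out : ∀ {S : Subset} {x y x′ y′} → (x , y) ≡ (x′ , y′) → (x , y) ∈ S → S x′ y′ ≡ false → ⊥
in-and-out refl s s̸ = case trans (sym s) s̸ of λ ()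

∸1-inverse : ∀ {x c} → 1 ≤ x → x ∸ 1 ≡ c → x ≡ suc c
∸1-inverse {suc x} _ refl = refl

∸2-inverse : ∀ {x c} → 2 ≤ x → x ∸ 2 ≡ c → x ≡ suc (suc c)
∸2-inverse {suc zero}    (s≤s ()) _
∸2-inverse {suc (suc x)} _        refl = refl

+1-inverse : ∀ {x c} → x + 1 ≡ c → x ≡ c ∸ 1
+1-inverse {x} refl = sym (m+n∸n≡m x 1)

Supported : ℕ → Subset → ℕ → ℕ → Set
Supported n S x y =
  (2 ≤ y → (2 ≤ x → (x ∸ 1 , y ∸ 1) ∈ S) × (x ≤ n ∸ 1 → (x + 1 , y ∸ 1) ∈ S)) ×
  (3 ≤ x → (x ∸ 2 , y) ∈ S)

leftPyramidal⇔ : ∀ n S →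
  LeftPyramidal n S ⇔ (SubsetV₁ n S × (∀ x y → (x , y) ∈ S → Supported n S x y))
leftPyramidal⇔ n S = mk⇔
  (λ ((inV₁ , below) , beside) → inV₁ , λ x y s → below x y s , beside x y s)
  (λ (inV₁ , supported) →
     (inV₁ , λ x y s → proj₁ (supported x y s)) , λ x y s → proj₂ (supported x y s))

-- Exchanging w = (c , d) for u keeps a set left-pyramidal, provided u ∈ V₁ is
-- supported in the new set and none of the three vertices that may need w as a
-- support, (c+1 , d+1), (c-1 , d+1) and (c+2 , d), lies in the old set.
exchange-leftPyramidal : ∀ n {Q Q′ c d e f} → IsExchange Q Q′ (c , d) (e , f) →
  LeftPyramidal n Q → InV₁ n e f → Supported n Q′ e f →
  Q (suc c) (suc d) ≡ false → Q (c ∸ 1) (suc d) ≡ false → Q (suc (suc c)) d ≡ false →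
  LeftPyramidal n Q′
exchange-leftPyramidal n {Q} {Q′} {c} {d} exchange LP u-V₁ u-supported
                       above-right above-left two-right =
  from (leftPyramidal⇔ n Q′) (inV₁′ , supported′)
  where
  inV₁ : SubsetV₁ n Q
  inV₁ = proj₁ (to (leftPyramidal⇔ n Q) LP)
  supported : ∀ x y → (x , y) ∈ Q → Supported n Q x y
  supported = proj₂ (to (leftPyramidal⇔ n Q) LP)
  keep : ∀ {x y} → (x , y) ∈ Q → (x , y) ≢ (c , d) → (x , y) ∈ Q′
  keep q ≢w = from (exchange _ _) (inj₁ (q , ≢w))
  inV₁′ : SubsetV₁ n Q′
  inV₁′ x y q′ with to (exchange x y) q′
  ... | inj₁ (q , _) = inV₁ x y q
  ... | inj₂ refl    = u-V₁
  supported′ : ∀ x y → (x , y) ∈ Q′ → Supported n Q′ x y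
  supported′ x y q′ with to (exchange x y) q′
  ... | inj₂ refl    = u-supported
  ... | inj₁ (q , _) =
    (λ 2≤y → (λ 2≤x → keep (proj₁ (below 2≤y) 2≤x) λ eq →
                in-and-out {Q} (cong₂ _,_ (∸1-inverse (<⇒≤ 2≤x) (cong proj₁ eq))
                                      (∸1-inverse (<⇒≤ 2≤y) (cong proj₂ eq))) q above-right) ,
             (λ x≤n-1 → keep (proj₂ (below 2≤y) x≤n-1) λ eq →
                in-and-out {Q} (cong₂ _,_ (+1-inverse (cong proj₁ eq))
                                      (∸1-inverse (<⇒≤ 2≤y) (cong proj₂ eq))) q above-left)) ,
    (λ 3≤x → keep (beside 3≤x) λ eq →
       in-and-out {Q} (cong₂ _,_ (∸2-inverse (<⇒≤ 3≤x) (cong proj₁ eq)) (cong proj₂ eq)) q two-right)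
    where
    below : 2 ≤ y → (2 ≤ x → (x ∸ 1 , y ∸ 1) ∈ Q) × (x ≤ n ∸ 1 → (x + 1 , y ∸ 1) ∈ Q)
    below = proj₁ (supported x y q)
    beside : 3 ≤ x → (x ∸ 2 , y) ∈ Q
    beside = proj₂ (supported x y q)

-- After exchanging w for u a vertex can only enter the neighbourhood by being
-- adjacent to u; so if every grid vertex adjacent to u other than a already has a
-- neighbour in Q, then N(Q′) ⊆ N(Q) ∪ {a}.  (Parity keeps such vertices outside Q.)
exchange-neighbourhood : ∀ n {Q Q′ w u a} → IsExchange Q Q′ w u → SubsetV₁ n Q → SubsetV₁ n Q′ →
  (∀ x y d → InGrid n x y → step d x y ≡ u → (x , y) ≢ a →
     Σ Direction (λ d′ → Occupied n Q (step d′ x y))) →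
  ∀ x y → InN n Q′ x y → InN n Q x y ⊎ (x , y) ≡ a
exchange-neighbourhood n {Q} {a = a} exchange inV₁ inV₁′ u-covered x y
                       (grid , _ , d , grid-v , v∈Q′) =
  case to (exchange _ _) v∈Q′ of λ where
    (inj₁ (v∈Q , _)) → inj₁ (grid , outside , d , grid-v , v∈Q)
    (inj₂ v≡u)       → case ≡-dec _≟_ _≟_ (x , y) a of λ where
      (yes isA)  → inj₂ isA
      (no  notA) → inj₁ (grid , outside , u-covered x y d grid v≡u notA)
  where
  outside : Q x y ≡ false
  outside = ¬-not (λ q → V₁-independent n d (inV₁ x y q) (inV₁′ _ _ v∈Q′))

δ-exchange : ∀ n {Q Q′ a b₁ b₂} → (∀ x y → InN n Q′ x y → InN n Q x y ⊎ (x , y) ≡ a) →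
  InN n Q b₁ b₂ → ¬ InN n Q′ b₁ b₂ → δ n Q′ ≤ δ n Q
δ-exchange n {Q} {Q′} {b₁ = b₁} {b₂} N′⊆N∪a b∈N b∉N′ =
  subst₂ _≤_ (sym (δ≡count n Q′)) (sym (δ≡count n Q))
    (count-exchange n (inNᵇ n Q) (inNᵇ n Q′) (proj₁ b∈N)
      (from (inN⇔ n Q b₁ b₂) b∈N) (¬-not (b∉N′ ∘′ to (inN⇔ n Q′ b₁ b₂)))
      (λ x y e → map₁ (from (inN⇔ n Q x y)) (N′⊆N∪a x y (to (inN⇔ n Q′ x y) e))))

spot-grid : ∀ {n Q i j} → LeftSpot n Q i j → InGrid n (i ∸ 1) (suc j)
spot-grid {n} {i = i} {j} (_ , grid , _) = subst (InGrid n (i ∸ 1)) (+-comm j 1) grid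

spot-vacancy : ∀ {n Q i j} → LeftSpot n Q i j → Q (i ∸ 1) (suc j) ≡ false
spot-vacancy {Q = Q} {i} {j} (_ , _ , vacant) =
  subst (λ y → Q (i ∸ 1) y ≡ false) (+-comm j 1) vacant

-- Above-right of a left spot is empty: otherwise left-closure would fill the vacancy.
spot-above-right : ∀ {n Q i j} → LeftPyramidal n Q → LeftSpot n Q i j → Q (suc i) (suc j) ≡ false
spot-above-right {Q = Q} {suc (suc p)} LP spot =
  ¬-not (λ q → in-and-out {Q} refl (proj₂ LP _ _ q (s≤s (s≤s (s≤s z≤n))))
                         (spot-vacancy {Q = Q} {suc (suc p)} spot))

-- Two steps above a left spot is empty: otherwise the pyramid would fill the vacancy.
spot-above : ∀ {n Q i j} → LeftPyramidal n Q → LeftSpot n Q i j → Q i (suc (suc j)) ≡ false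
spot-above {Q = Q} {suc (suc p)} LP spot =
  ¬-not (λ q → in-and-out {Q} refl (proj₁ (proj₂ (proj₁ LP) _ _ q (s≤s (s≤s z≤n))) (s≤s (s≤s z≤n)))
                         (spot-vacancy {Q = Q} {suc (suc p)} spot))

spot-two-right : ∀ {n Q i j} → LeftPyramidal n Q → LeftSpot n Q i j →
  (suc (suc i) , j) ∈ Q → LeftSpot n Q (suc (suc i)) j
spot-two-right {n} {Q} {i} {j} LP spot@(_ , (_ , _ , 1≤j+1 , j+1≤n) , _) q =
  q , (s≤s z≤n , <⇒≤ i+2≤n , 1≤j+1 , j+1≤n) ,
  subst (λ y → Q (suc i) y ≡ false) (sym (+-comm j 1)) (spot-above-right LP spot)
  where
  i+2≤n : suc (suc i) ≤ n
  i+2≤n = proj₁ (proj₂ (proj₁ (proj₁ (proj₁ LP) _ _ q)))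

spot-two-left : ∀ {n Q i j} → LeftPyramidal n Q → LeftSpot n Q i j → 4 ≤ i →
  Q (i ∸ 3) (suc j) ≡ false → LeftSpot n Q (i ∸ 2) j
spot-two-left {i = suc (suc zero)}       _ _ (s≤s (s≤s ())) _
spot-two-left {i = suc (suc (suc zero))} _ _ (s≤s (s≤s (s≤s ()))) _
spot-two-left {Q = Q} {suc (suc (suc (suc p)))} {j} LP
              (q , (_ , i-1≤n , 1≤j+1 , j+1≤n) , _) _ vacant =
  proj₂ LP _ _ q (s≤s (s≤s (s≤s z≤n))) ,
  (s≤s z≤n , ≤-trans (n≤1+n _) (≤-trans (n≤1+n _) i-1≤n) , 1≤j+1 , j+1≤n) ,
  subst (λ y → Q (suc p) y ≡ false) (sym (+-comm j 1)) vacant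

-- The setting of the theorem: Q is left-pyramidal with left spots (i₁ , j₁) and
-- (i₂ , j₂) of least and greatest x-coordinate; left spots have x-coordinate ≥ 2.
module ExtremeSpots (n : ℕ) (Q : Subset) (p₁ j₁ p₂ j₂ : ℕ) (LP : LeftPyramidal n Q)
  (spot₁ : LeftSpot n Q (suc (suc p₁)) j₁) (spot₂ : LeftSpot n Q (suc (suc p₂)) j₂)
  (distinct : _≢_ {A = ℕ × ℕ} (suc (suc p₁) , j₁) (suc (suc p₂) , j₂))
  (extreme : ∀ i j → LeftSpot n Q i j → (suc (suc p₁) ≤ i) × (i ≤ suc (suc p₂))) where

  i₁ i₂ : ℕ
  i₁ = suc (suc p₁)
  i₂ = suc (suc p₂)

  Q′ : Subset
  Q′ = move Q i₁ j₁ i₂ j₂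

  -- the added vertex u = (i₁ - 1 , j₁ + 1) and the removed vertex w = (i₂ , j₂)
  exchange : IsExchange Q Q′ (i₂ , j₂) (suc p₁ , suc j₁)
  exchange = subst (IsExchange Q Q′ (i₂ , j₂)) (cong (suc p₁ ,_) (+-comm j₁ 1))
                   (move-isExchange Q i₁ j₁ i₂ j₂)

  keep : ∀ {x y} → (x , y) ∈ Q → (x , y) ≢ (i₂ , j₂) → (x , y) ∈ Q′
  keep q ≢w = from (exchange _ _) (inj₁ (q , ≢w))

  inV₁ : SubsetV₁ n Q
  inV₁ = proj₁ (proj₁ LP)

  q₁ : (i₁ , j₁) ∈ Q
  q₁ = proj₁ spot₁

  q₂ : (i₂ , j₂) ∈ Q
  q₂ = proj₁ spot₂

  grid₁ : InGrid n i₁ j₁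
  grid₁ = proj₁ (inV₁ _ _ q₁)

  p₁≤p₂ : p₁ ≤ p₂
  p₁≤p₂ = ≤-pred (≤-pred (proj₂ (extreme _ _ spot₁)))

  p₁<i₂ : p₁ < i₂
  p₁<i₂ = s≤s (m≤n⇒m≤1+n p₁≤p₂)

  u<i₂ : suc p₁ < i₂
  u<i₂ = s≤s (s≤s p₁≤p₂)

  no-spot-left-of-i₁ : ∀ {x y} → LeftSpot n Q x y → x < i₁ → ⊥
  no-spot-left-of-i₁ spot x<i₁ = <⇒≱ x<i₁ (proj₁ (extreme _ _ spot))

  no-spot-right-of-i₂ : ∀ {x y} → LeftSpot n Q x y → i₂ < x → ⊥
  no-spot-right-of-i₂ spot i₂<x = <⇒≱ i₂<x (proj₂ (extreme _ _ spot))

  left-of-w : ∀ {x y} → x < i₂ → _≢_ {A = ℕ × ℕ} (x , y) (i₂ , j₂)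
  left-of-w x<i₂ = <⇒≢ x<i₂ ∘′ cong proj₁

  right-of-u : ∀ {x y} → suc p₁ < x → _≢_ {A = ℕ × ℕ} (x , y) (suc p₁ , suc j₁)
  right-of-u u<x = <⇒≢ u<x ∘′ sym ∘′ cong proj₁

  -- u lies in V₁: its coordinate sum equals that of (i₁ , j₁)
  u-inV₁ : InV₁ n (suc p₁) (suc j₁)
  u-inV₁ = spot-grid {Q = Q} {i₁} spot₁ ,
    subst (λ m → suc m % 2 ≡ 0) (sym (+-suc p₁ j₁)) (proj₂ (inV₁ _ _ q₁))

  -- (i₁ - 3 , j₁ + 1) must be in Q, as otherwise (i₁ - 2 , j₁) would be a spot left of i₁
  u-beside : 3 ≤ suc p₁ → (p₁ ∸ 1 , suc j₁) ∈ Q′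
  u-beside 3≤u = by-cases _ refl
    where
    by-cases : ∀ b → Q (p₁ ∸ 1) (suc j₁) ≡ b → (p₁ ∸ 1 , suc j₁) ∈ Q′
    by-cases true  q      = keep q (left-of-w (≤-<-trans (m∸n≤m p₁ 1) p₁<i₂))
    by-cases false vacant = ⊥-elim (no-spot-left-of-i₁ (spot-two-left LP spot₁ (s≤s 3≤u) vacant)
                                                       (<-trans (n<1+n p₁) (n<1+n (suc p₁))))

  u-supported : Supported n Q′ (suc p₁) (suc j₁)
  u-supported =
    (λ _ → (λ 2≤u → keep (proj₂ LP _ _ q₁ (s≤s 2≤u)) (left-of-w p₁<i₂)) ,
           (λ _ → subst (λ x → (x , j₁) ∈ Q′) (sym (+-comm (suc p₁) 1)) (keep q₁ distinct))) ,
    u-beside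

  -- (i₂ + 2 , j₂) is not in Q, as otherwise it would be a spot right of i₂
  w-two-right : Q (suc (suc i₂)) j₂ ≡ false
  w-two-right = ¬-not (λ q → no-spot-right-of-i₂ (spot-two-right LP spot₂ q)
                                                 (<-trans (n<1+n i₂) (n<1+n (suc i₂))))

  leftPyramidal′ : LeftPyramidal n Q′
  leftPyramidal′ = exchange-leftPyramidal n exchange LP u-inV₁ u-supported
    (spot-above-right LP spot₂) (spot-vacancy {Q = Q} {i₂} spot₂) w-two-right

  -- Every grid vertex adjacent to u except a = (i₁ - 1 , j₁ + 2) already has a neighbour
  -- in Q: (i₁ - 2 , j₁ + 1) and (i₁ , j₁ + 1) sit above (i₁ - 2 , j₁) and (i₁ , j₁),
  -- and (i₁ - 1 , j₁) sits left of (i₁ , j₁).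
  u-covered : ∀ x y d → InGrid n x y → step d x y ≡ (suc p₁ , suc j₁) →
    _≢_ {A = ℕ × ℕ} (x , y) (suc p₁ , suc (suc j₁)) →
    Σ Direction (λ d′ → Occupied n Q (step d′ x y))
  u-covered x y right (1≤p₁ , p₁≤n , _) refl _ =
    down , (1≤p₁ , p₁≤n , proj₂ (proj₂ grid₁)) , proj₂ LP _ _ q₁ (s≤s (s≤s 1≤p₁))
  u-covered (suc x) y left  _ refl _   = down , grid₁ , q₁
  u-covered x       y up    _ refl _   = right , grid₁ , q₁
  u-covered x (suc y) down  _ refl ≢a  = ⊥-elim (≢a refl)

  -- b = (i₂ , j₂ + 1), the vertex above w, is in N(Q) ...
  b∈N : InN n Q i₂ (suc j₂)
  b∈N = (s≤s z≤n , proj₁ (proj₂ (proj₁ (inV₁ _ _ q₂))) , s≤s z≤n ,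
         proj₂ (proj₂ (proj₂ (spot-grid {Q = Q} {i₂} spot₂)))) ,
        ¬-not (λ q → V₁-independent n up (inV₁ _ _ q₂) (inV₁ _ _ q)) ,
        down , proj₁ (inV₁ _ _ q₂) , q₂

  -- ... but not in N(Q′): w was removed, and its other three neighbours are not in Q′
  b∉N′ : ¬ InN n Q′ i₂ (suc j₂)
  b∉N′ (_ , _ , right , _ , q′) with to (exchange _ _) q′
  ... | inj₁ (q , _) = in-and-out {Q} refl q (spot-above-right LP spot₂)
  ... | inj₂ isU     = right-of-u (≤-trans u<i₂ (n≤1+n i₂)) isU
  b∉N′ (_ , _ , left , _ , q′) with to (exchange _ _) q′
  ... | inj₁ (q , _) = in-and-out {Q} refl q (spot-vacancy {Q = Q} {i₂} spot₂)
  ... | inj₂ isU     = distinct (cong (λ v → suc (proj₁ v) , pred (proj₂ v)) (sym isU))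
  b∉N′ (_ , _ , up , _ , q′) with to (exchange _ _) q′
  ... | inj₁ (q , _) = in-and-out {Q} refl q (spot-above LP spot₂)
  ... | inj₂ isU     = right-of-u u<i₂ isU
  b∉N′ (_ , _ , down , _ , q′) with to (exchange _ _) q′
  ... | inj₁ (_ , ≢w) = ≢w refl
  ... | inj₂ isU      = right-of-u u<i₂ isU

  δ′≤δ : δ n Q′ ≤ δ n Q
  δ′≤δ = δ-exchange n
    (exchange-neighbourhood n exchange inV₁ (proj₁ (proj₁ leftPyramidal′)) u-covered) b∈N b∉N′

spot-column : ∀ {n Q i j} → LeftSpot n Q i j → Σ ℕ (λ p → i ≡ suc (suc p))
spot-column {i = suc (suc p)} _ = p , refl

lemma7 : (n : ℕ) (Q : Subset) (i₁ j₁ i₂ j₂ : ℕ) →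
    LeftPyramidal n Q →
    LeftSpot n Q i₁ j₁ →
    LeftSpot n Q i₂ j₂ →
    ¬ ((i₁ , j₁) ≡ (i₂ , j₂)) →
    (∀ i j → LeftSpot n Q i j → (i₁ ≤ i) × (i ≤ i₂)) →
    LeftPyramidal n (move Q i₁ j₁ i₂ j₂) × (δ n (move Q i₁ j₁ i₂ j₂) ≤ δ n Q)
lemma7 n Q i₁ j₁ i₂ j₂ LP spot₁ spot₂ distinct extreme
  with spot-column {n} {Q} spot₁ | spot-column {n} {Q} spot₂
... | p₁ , refl | p₂ , refl = leftPyramidal′ , δ′≤δ
  where open ExtremeSpots n Q p₁ j₁ p₂ j₂ LP spot₁ spot₂ distinct extreme
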